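{- Let $f(t)\neq 0$ be a Castelnuovo polynomial with $d=\deg f(t)>0$, and put $f^*(t)=f(t)-t^{d-1}-t^d$. If $f^*(t)$ is not a Castelnuovo polynomial, then $$f(t)=1+2t+3t^2+\dots+(u+1)t^u$$ for some integer $u>0$.
   Context: A Castelnuovo function is a finitely supported function $s:\mathbb{N}\to\mathbb{N}$ such that, for some integer $\sigma\ge0$, $$s(0)=1,\ s(1)=2,\ \dots,\ s(\sigma-1)=\sigma\quad\text{and}\quad s(\sigma-1)\ge s(\sigma)\ge s(\sigma+1)\ge\cdots\ge 0.$$ A function $f:\mathbb{N}\to\mathbb{Z}$ with finite support is identified with its generating polynomial $\sum_n f(n)t^n$. A Castelnuovo polynomial is the generating polynomial of a Castelnuovo function. -}

module Defs where

open import Data.Nat using (ℕ; zero; suc; _≤_; _<_; _∸_; _≟_; _≤?_)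
open import Data.Integer using (ℤ; +_; _-_)
open import Data.Product using (Σ; ∃; _×_)
open import Data.Bool using (if_then_else_)
open import Relation.Nullary using (¬_)
open import Relation.Nullary.Decidable using (⌊_⌋)
open import Relation.Binary.PropositionalEquality using (_≡_)

-- A function ℕ → ℤ with finite support is identified with its generating
-- polynomial Σ f(n) tⁿ; we work with coefficient functions throughout.
Poly : Set
Poly = ℕ → ℤ

FinSupp : Poly → Set
FinSupp f = ∃ λ N → ∀ n → N ≤ n → f n ≡ + 0

-- Castelnuovo function: finitely supported s : ℕ → ℕ with some σ ≥ 0 s.t.
-- s(i) = i+1 for i < σ, and s(σ-1) ≥ s(σ) ≥ s(σ+1) ≥ ...
-- (for σ = 0 the chain is s(0) ≥ s(1) ≥ ...).
IsCastelnuovoFunction : (ℕ → ℕ) → Set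
IsCastelnuovoFunction s =
  FinSupp (λ n → + s n) ×
  (∃ λ σ → (∀ i → i < σ → s i ≡ suc i) ×
           (∀ i → σ ≤ suc i → s (suc i) ≤ s i))

IsCastelnuovoPoly : Poly → Set
IsCastelnuovoPoly f =
  Σ (ℕ → ℕ) λ s → IsCastelnuovoFunction s × (∀ n → f n ≡ + s n)

IsZeroPoly : Poly → Set
IsZeroPoly f = ∀ n → f n ≡ + 0

HasDegree : Poly → ℕ → Set
HasDegree f d = ¬ (f d ≡ + 0) × (∀ n → d < n → f n ≡ + 0)

monomial : ℕ → Poly
monomial k n = if ⌊ n ≟ k ⌋ then + 1 else + 0

fStar : Poly → ℕ → Poly
fStar f d n = f n - monomial (d ∸ 1) n - monomial d n

staircase : ℕ → Poly
staircase u n = if ⌊ n ≤? u ⌋ then + suc n else + 0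

module Submission where

-- Let s be the Castelnuovo function of f, with threshold σ, and d = deg f. If σ > d
-- then s(n) = n + 1 for every n ≤ d, so f is the staircase of length d. Otherwise
-- s(d-1) ≥ s(d) ≥ 1, so the coefficients of f* are s lowered by one at d-1 and at d,
-- still natural numbers. Lowering the last two nonzero values by one keeps the tail
-- non-increasing (s(d+1) = 0 and s(d) - 1 ≤ s(d-1) - 1), and the initial staircase
-- survives below d-1; the threshold becomes σ if σ < d and d-1 if σ = d.

open import Defs
open import Data.Nat using (ℕ; zero; suc; _≤_; _<_; _∸_; _≟_; _≤?_; z≤n; s≤s; s≤s⁻¹)
open import Data.Nat.Properties
  using (≤-refl; ≤-trans; ≤-reflexive; ≤-antisym; <-≤-trans; <-irrefl; ≰⇒>;
         n≤1+n; n≤0⇒n≡0; m∸n≤m; ∸-monoˡ-≤; 1+n≢n; module ≤-Reasoning)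
open import Data.Integer using (+_; _-_; _⊖_)
open import Data.Integer.Properties using (+-injective; m-n≡m⊖n; ⊖-≥)
open import Data.Product using (∃; _×_; _,_)
open import Data.Bool using (if_then_else_)
open import Data.Empty using (⊥-elim)
open import Relation.Nullary using (¬_; Dec; yes; no)
open import Relation.Nullary.Decidable using (⌊_⌋)
open import Relation.Binary.PropositionalEquality
  using (_≡_; _≢_; refl; sym; trans; cong; subst; module ≡-Reasoning)

InitialBelow : ℕ → (ℕ → ℕ) → Set
InitialBelow σ s = ∀ i → i < σ → s i ≡ suc i

AntitoneFrom : ℕ → (ℕ → ℕ) → Set
AntitoneFrom σ s = ∀ i → σ ≤ suc i → s (suc i) ≤ s i

initialBelow-mono : ∀ {s τ σ} → τ ≤ σ → InitialBelow σ s → InitialBelow τ s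
initialBelow-mono τ≤σ init i i<τ = init i (<-≤-trans i<τ τ≤σ)

antitoneFrom-pred : ∀ {s} σ → AntitoneFrom (suc σ) s →
  (∀ i → suc i ≡ σ → s σ ≤ s i) → AntitoneFrom σ s
antitoneFrom-pred {s} σ anti step i σ≤1+i with suc σ ≤? suc i
... | yes 1+σ≤1+i = anti i 1+σ≤1+i
... | no  1+σ≰1+i = subst (λ k → s k ≤ s i) (sym 1+i≡σ) (step i 1+i≡σ)
  where
  1+i≡σ : suc i ≡ σ
  1+i≡σ = ≤-antisym (s≤s⁻¹ (≰⇒> 1+σ≰1+i)) σ≤1+i

staircase-unique : ∀ {s} u → InitialBelow (suc u) s → (∀ n → u < n → s n ≡ 0) →
  ∀ n → + s n ≡ staircase u n
staircase-unique u init vanish n with n ≤? u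
... | yes n≤u = cong +_ (init n (s≤s n≤u))
... | no  n≰u = cong +_ (vanish n (≰⇒> n≰u))

finSupp-≤ : ∀ {s t : ℕ → ℕ} → (∀ n → t n ≤ s n) → FinSupp (λ n → + s n) → FinSupp (λ n → + t n)
finSupp-≤ t≤s (N , vanish) =
  N , λ n N≤n → cong +_ (n≤0⇒n≡0 (≤-trans (t≤s n) (≤-reflexive (+-injective (vanish n N≤n)))))

indicator : ℕ → ℕ → ℕ
indicator k n = if ⌊ n ≟ k ⌋ then 1 else 0

monomial≡indicator : ∀ k n → monomial k n ≡ + indicator k n
monomial≡indicator k n with n ≟ k
... | yes _ = refl
... | no  _ = refl

decrementAt : ℕ → (ℕ → ℕ) → ℕ → ℕ
decrementAt k s n = s n ∸ indicator k n

module _ {s : ℕ → ℕ} {k : ℕ} where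

  decrementAt-≤ : ∀ n → decrementAt k s n ≤ s n
  decrementAt-≤ n = m∸n≤m (s n) (indicator k n)

  decrementAt-self : decrementAt k s k ≡ s k ∸ 1
  decrementAt-self with k ≟ k
  ... | yes _   = refl
  ... | no  k≢k = ⊥-elim (k≢k refl)

  decrementAt-other : ∀ {n} → n ≢ k → decrementAt k s n ≡ s n
  decrementAt-other {n} n≢k with n ≟ k
  ... | yes n≡k = ⊥-elim (n≢k n≡k)
  ... | no  _   = refl

  indicator-≤ : 1 ≤ s k → ∀ n → indicator k n ≤ s n
  indicator-≤ 1≤sk n with n ≟ k
  ... | yes refl = 1≤sk
  ... | no  _    = z≤n

  decrementAt-monomial : 1 ≤ s k → ∀ n → + decrementAt k s n ≡ + s n - monomial k n
  decrementAt-monomial 1≤sk n = begin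
    + (s n ∸ indicator k n)     ≡⟨ sym (⊖-≥ (indicator-≤ 1≤sk n)) ⟩
    s n ⊖ indicator k n         ≡⟨ sym (m-n≡m⊖n (s n) (indicator k n)) ⟩
    + s n - + indicator k n     ≡⟨ cong (+ s n -_) (sym (monomial≡indicator k n)) ⟩
    + s n - monomial k n        ∎
    where open ≡-Reasoning

decrementPair : ℕ → (ℕ → ℕ) → ℕ → ℕ
decrementPair e s = decrementAt (suc e) (decrementAt e s)

module _ {s : ℕ → ℕ} {e : ℕ} where

  private
    s₁ s′ : ℕ → ℕ
    s₁ = decrementAt e s
    s′ = decrementAt (suc e) s₁

    1+e≢e : suc e ≢ e
    1+e≢e = 1+n≢n

    e≢1+e : e ≢ suc e
    e≢1+e e≡1+e = 1+e≢e (sym e≡1+e)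

  decrementPair-≤ : ∀ n → s′ n ≤ s n
  decrementPair-≤ n = ≤-trans (decrementAt-≤ {s₁} {suc e} n) (decrementAt-≤ {s} {e} n)

  decrementPair-other : ∀ {n} → n ≢ e → n ≢ suc e → s′ n ≡ s n
  decrementPair-other n≢e n≢1+e =
    trans (decrementAt-other {s₁} {suc e} n≢1+e) (decrementAt-other {s} {e} n≢e)

  decrementPair-below : ∀ {n} → n < e → s′ n ≡ s n
  decrementPair-below n<e =
    decrementPair-other (λ n≡e → <-irrefl n≡e n<e)
                        (λ n≡1+e → <-irrefl n≡1+e (≤-trans n<e (n≤1+n e)))

  decrementPair-first : s′ e ≡ s e ∸ 1
  decrementPair-first = trans (decrementAt-other {s₁} {suc e} e≢1+e) (decrementAt-self {s} {e})

  decrementPair-second : s′ (suc e) ≡ s (suc e) ∸ 1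
  decrementPair-second =
    trans (decrementAt-self {s₁} {suc e}) (cong (_∸ 1) (decrementAt-other {s} {e} 1+e≢e))

  fStar≡decrementPair : ∀ {f} → (∀ n → f n ≡ + s n) → 1 ≤ s e → 1 ≤ s (suc e) →
    ∀ n → fStar f (suc e) n ≡ + s′ n
  fStar≡decrementPair {f} f≡s 1≤se 1≤s1+e n = begin
    f n - monomial e n - monomial (suc e) n
      ≡⟨ cong (λ x → x - monomial e n - monomial (suc e) n) (f≡s n) ⟩
    + s n - monomial e n - monomial (suc e) n
      ≡⟨ cong (_- monomial (suc e) n) (sym (decrementAt-monomial {s} {e} 1≤se n)) ⟩
    + s₁ n - monomial (suc e) n
      ≡⟨ sym (decrementAt-monomial {s₁} {suc e} 1≤s₁1+e n) ⟩
    + s′ n ∎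
    where
    open ≡-Reasoning
    1≤s₁1+e : 1 ≤ s₁ (suc e)
    1≤s₁1+e = subst (1 ≤_) (sym (decrementAt-other {s} {e} 1+e≢e)) 1≤s1+e

  decrementPair-antitoneFrom : ∀ {σ} → AntitoneFrom σ s → σ ≤ suc e → s (suc (suc e)) ≡ 0 →
    AntitoneFrom σ s′
  decrementPair-antitoneFrom anti σ≤1+e vanish i σ≤1+i = cases (i ≟ e) (i ≟ suc e)
    where
    cases : Dec (i ≡ e) → Dec (i ≡ suc e) → s′ (suc i) ≤ s′ i
    cases (yes refl) _ = begin
      s′ (suc e)      ≡⟨ decrementPair-second ⟩
      s (suc e) ∸ 1   ≤⟨ ∸-monoˡ-≤ 1 (anti e σ≤1+e) ⟩
      s e ∸ 1         ≡⟨ decrementPair-first ⟨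
      s′ e            ∎
      where open ≤-Reasoning
    cases (no _) (yes refl) =
      ≤-trans (decrementPair-≤ (suc (suc e))) (subst (_≤ s′ (suc e)) (sym vanish) z≤n)
    cases (no i≢e) (no i≢1+e) = begin
      s′ (suc i)  ≤⟨ decrementPair-≤ (suc i) ⟩
      s (suc i)   ≤⟨ anti i σ≤1+i ⟩
      s i         ≡⟨ decrementPair-other i≢e i≢1+e ⟨
      s′ i        ∎
      where open ≤-Reasoning

  decrementPair-isCastelnuovo : ∀ {σ} → FinSupp (λ n → + s n) → InitialBelow σ s →
    AntitoneFrom σ s → σ ≤ suc e → s (suc (suc e)) ≡ 0 → IsCastelnuovoFunction s′
  decrementPair-isCastelnuovo {σ} fin init anti σ≤1+e vanish =
    finSupp-≤ decrementPair-≤ fin , threshold (σ ≤? e)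
    where
    anti′ : AntitoneFrom σ s′
    anti′ = decrementPair-antitoneFrom anti σ≤1+e vanish

    init′ : ∀ {τ} → τ ≤ e → τ ≤ σ → InitialBelow τ s′
    init′ τ≤e τ≤σ i i<τ =
      trans (decrementPair-below (<-≤-trans i<τ τ≤e)) (init i (<-≤-trans i<τ τ≤σ))

    threshold : Dec (σ ≤ e) → ∃ λ τ → InitialBelow τ s′ × AntitoneFrom τ s′
    threshold (yes σ≤e) = σ , init′ σ≤e ≤-refl , anti′
    threshold (no σ≰e)  =
      e , init′ ≤-refl e≤σ , antitoneFrom-pred e (subst (λ τ → AntitoneFrom τ s′) σ≡1+e anti′) step
      where
      σ≡1+e : σ ≡ suc e
      σ≡1+e = ≤-antisym σ≤1+e (≰⇒> σ≰e)

      e≤σ : e ≤ σ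
      e≤σ = ≤-trans (n≤1+n e) (≤-reflexive (sym σ≡1+e))

      step : ∀ i → suc i ≡ e → s′ e ≤ s′ i
      step i 1+i≡e = ≤-reflexive (begin
        s′ e      ≡⟨ decrementPair-first ⟩
        s e ∸ 1   ≡⟨ cong (_∸ 1) (init e (≤-reflexive (sym σ≡1+e))) ⟩
        e         ≡⟨ 1+i≡e ⟨
        suc i     ≡⟨ init′ ≤-refl e≤σ i (≤-reflexive 1+i≡e) ⟨
        s′ i      ∎)
        where open ≡-Reasoning

mainTheorem4 : (f : Poly) (d : ℕ) → IsCastelnuovoPoly f → ¬ IsZeroPoly f →
    HasDegree f d → 0 < d → ¬ IsCastelnuovoPoly (fStar f d) →
    ∃ λ u → 0 < u × (∀ n → f n ≡ staircase u n)
mainTheorem4 f (suc e) (s , (fin , σ , init , anti) , f≡s) _ (fd≢0 , f>d≡0) (s≤s z≤n) f*-not-C =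
  dichotomy (σ ≤? suc e)
  where
  s>d≡0 : ∀ n → suc e < n → s n ≡ 0
  s>d≡0 n d<n = +-injective (trans (sym (f≡s n)) (f>d≡0 n d<n))

  1≤sd : 1 ≤ s (suc e)
  1≤sd with s (suc e) in sd≡
  ... | zero  = ⊥-elim (fd≢0 (trans (f≡s (suc e)) (cong +_ sd≡)))
  ... | suc _ = s≤s z≤n

  dichotomy : Dec (σ ≤ suc e) → ∃ λ u → 0 < u × (∀ n → f n ≡ staircase u n)
  dichotomy (yes σ≤d) = ⊥-elim (f*-not-C (decrementPair e s ,
    decrementPair-isCastelnuovo fin init anti σ≤d (s>d≡0 _ ≤-refl) ,
    fStar≡decrementPair f≡s (≤-trans 1≤sd (anti e σ≤d)) 1≤sd))
  dichotomy (no σ≰d) = suc e , s≤s z≤n , λ n →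
    trans (f≡s n) (staircase-unique (suc e) (initialBelow-mono (≰⇒> σ≰d) init) s>d≡0 n)
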